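{- Let $C$ be a finite set of constants, $f$ an AC symbol, $S=S_C\cup S_f$ a finite set of ground equations where $S_C$ consists of equations between constants and $S_f$ of equations between $f$-monomials over $C$, and $\gg_f$ a total admissible ordering on $f$-monomials extending a total ordering on $C$. Then the rewrite system $R_f$ output by SingleACCompletion$(S,\gg_f)$ is canonical (terminating and confluent) and decides $ACCC(S)$: for all $f$-monomials $s,t$, $s=t\in ACCC(S)$ if and only if $s$ and $t$ have the same normal form with respect to $R_f$.
   Context: $f$-monomials: $f(M)$ with $M$ a nonempty finite multiset over $C$; a constant $c$ is identified with $f(\{\!\{c\}\!\})$. On multisets $\cup$ is multiset sum, $\cap$ multiset intersection (min of multiplicities), $-$ truncated multiset difference, $\subseteq$ sub-multiset. A rule $f(A)\rightarrow f(B)$ rewrites $f(M)$ to $f((M-A)\cup B)$ when $A\subseteq M$. Admissible ordering: a total well-founded ordering $\gg_f$ on $f$-monomials extending a total ordering $\gg$ on $C$ with $f(A)\gg_f f(B)$ whenever $B$ is a proper sub-multiset of $A$, and $f(A_1)\gg_f f(A_2)\Rightarrow f(A_1\cup B)\gg_f f(A_2\cup B)$. $ACCC(S)$ is the smallest equivalence relation on $f$-monomials containing $S$ and such that $f(M_1)=f(M_2)$ and $f(N_1)=f(N_2)$ in it imply $f(M_1\cup N_1)=f(M_2\cup N_2)$ in it. Critical pair of distinct rules $f(A_1)\rightarrow f(A_2)$, $f(B_1)\rightarrow f(B_2)$: $(f((AB-A_1)\cup A_2), f((AB-B_1)\cup B_2))$ with $AB=(A_1\cup B_1)-(A_1\cap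 B_1)$. Algorithm SingleACCompletion$(S_f\cup S_C,\gg_f)$: (1) For each constant $c$ let $\hat c$ be the $\gg$-least constant in its equivalence class generated by $S_C$; $R_C=\{c\rightarrow\hat c\mid c\ne\hat c\}$; $R_f:=R_C$, $T:=S_f$. (2) Pick and remove $l=r$ from $T$; compute normal forms $\hat l,\hat r$ w.r.t. $R_f$; if equal discard, else orient with $\gg_f$ into $\hat l\rightarrow\hat r$ ($\hat l\gg_f\hat r$). (3) Add to $T$ the critical pairs between $\hat l\rightarrow\hat r$ and every rule of $R_f$. (4) Add $\hat l\rightarrow\hat r$ to $R_f$; for each other rule $l\rightarrow r$ of $R_f$: if $l$ is reducible by the new rule, move $l=r$ to $T$; else if $r$ is reducible, replace $r$ by a normal form of its reduct. (5) Repeat (2)–(4) until $T$ is empty and all critical pairs among rules of $R_f$ are joinable. (6) Output $R_f$. -}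

module Defs where

open import Level using (0ℓ)
open import Data.Bool using (Bool; true; false; T)
open import Data.Unit using (tt)
open import Data.Nat using (ℕ; zero; suc; _+_; _∸_; _⊓_; _≤_)
open import Data.Fin using (Fin; zero; suc; _≟_)
open import Data.Fin.Base using ()
open import Data.Vec using (Vec; []; _∷_; zipWith; replicate)
open import Data.Vec.Relation.Binary.Pointwise.Inductive using (Pointwise)
open import Data.List using (List; []; _∷_; _++_; map; filter; allFin)
open import Data.List.Membership.Propositional using (_∈_)
open import Data.Product using (Σ; ∃; ∃-syntax; _×_; _,_; proj₁; proj₂)
open import Data.Sum using (_⊎_)
open import Relation.Nullary using (¬_; ¬?)
open import Relation.Binary using (Rel; IsStrictTotalOrder)
open import Relation.Binary.PropositionalEquality using (_≡_; _≢_)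
open import Relation.Binary.Construct.Closure.ReflexiveTransitive using (Star)
open import Induction.WellFounded using (WellFounded)
open import Function using (flip; _⇔_)

-- Multisets over the constants C = Fin n, as multiplicity vectors.

MSet : ℕ → Set
MSet n = Vec ℕ n

-- multiset sum (∪ in the paper), intersection, truncated difference
_⊕_ : ∀ {n} → MSet n → MSet n → MSet n
_⊕_ = zipWith _+_

_⊗_ : ∀ {n} → MSet n → MSet n → MSet n
_⊗_ = zipWith _⊓_

_⊖_ : ∀ {n} → MSet n → MSet n → MSet n
_⊖_ = zipWith _∸_

_⊆ₘ_ : ∀ {n} → MSet n → MSet n → Set
A ⊆ₘ M = Pointwise _≤_ A M

_⊂ₘ_ : ∀ {n} → MSet n → MSet n → Set
A ⊂ₘ M = A ⊆ₘ M × A ≢ M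

nz : ∀ {n} → MSet n → Bool
nz [] = false
nz (zero ∷ v) = nz v
nz (suc _ ∷ v) = true

nz-⊕ʳ : ∀ {n} (u v : MSet n) → T (nz v) → T (nz (u ⊕ v))
nz-⊕ʳ (suc x ∷ u) (y ∷ v) p = tt
nz-⊕ʳ (zero ∷ u) (zero ∷ v) p = nz-⊕ʳ u v p
nz-⊕ʳ (zero ∷ u) (suc y ∷ v) p = tt

single : ∀ {n} → Fin n → MSet n
single zero = 1 ∷ replicate _ 0
single (suc c) = 0 ∷ single c

nz-single : ∀ {n} (c : Fin n) → T (nz (single c))
nz-single zero = tt
nz-single (suc c) = nz-single c

-- f-monomials f(M), M a nonempty finite multiset over C.
-- (The nonemptiness proof is irrelevant, so equality of monomials is
-- equality of their multisets.)

record Mono (n : ℕ) : Set where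
  constructor mono
  field
    ms : MSet n
    .nonempty : T (nz ms)
open Mono public

-- the constant c, identified with f({{c}})
const : ∀ {n} → Fin n → Mono n
const c = mono (single c) (nz-single c)

_∪_ : ∀ {n} → Mono n → Mono n → Mono n
M ∪ mono N p = mono (ms M ⊕ N) (nz-⊕ʳ (ms M) N p)

record Admissible {n : ℕ} (_≫_ : Rel (Fin n) 0ℓ) : Set₁ where
  field
    _≫f_ : Rel (Mono n) 0ℓ
    totalOrder : IsStrictTotalOrder _≡_ _≫f_
    wellFounded : WellFounded (flip _≫f_)
    extends : ∀ c d → c ≫ d → const c ≫f const d
    subset : ∀ (A B : Mono n) → ms B ⊂ₘ ms A → A ≫f B
    monotone : ∀ (A₁ A₂ B : Mono n) → A₁ ≫f A₂ → (A₁ ∪ B) ≫f (A₂ ∪ B)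

Equation : ℕ → Set
Equation n = Mono n × Mono n

record Rule (n : ℕ) : Set where
  constructor _⟶_
  field
    lhs : Mono n
    rhs : Mono n
open Rule public

apply : ∀ {n} → Rule n → Mono n → Mono n
apply (A ⟶ mono B p) M = mono ((ms M ⊖ ms A) ⊕ B) (nz-⊕ʳ (ms M ⊖ ms A) B p)

_⊢_⟶₁_ : ∀ {n} → List (Rule n) → Mono n → Mono n → Set
R ⊢ s ⟶₁ t = ∃[ ρ ] (ρ ∈ R × ms (lhs ρ) ⊆ₘ ms s × t ≡ apply ρ s)

_⊢_⟶*_ : ∀ {n} → List (Rule n) → Mono n → Mono n → Set
R ⊢ s ⟶* t = Star (R ⊢_⟶₁_) s t

Reducible : ∀ {n} → List (Rule n) → Mono n → Set
Reducible R s = ∃[ t ] (R ⊢ s ⟶₁ t)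

NormalForm : ∀ {n} → List (Rule n) → Mono n → Mono n → Set
NormalForm R s u = R ⊢ s ⟶* u × ¬ Reducible R u

Joinable : ∀ {n} → List (Rule n) → Mono n → Mono n → Set
Joinable R s t = ∃[ u ] (R ⊢ s ⟶* u × R ⊢ t ⟶* u)

Terminating : ∀ {n} → List (Rule n) → Set
Terminating R = WellFounded (flip (R ⊢_⟶₁_))

Confluent : ∀ {n} → List (Rule n) → Set
Confluent R = ∀ s t u → R ⊢ s ⟶* t → R ⊢ s ⟶* u → Joinable R t u

Canonical : ∀ {n} → List (Rule n) → Set
Canonical R = Terminating R × Confluent R

criticalPair : ∀ {n} → Rule n → Rule n → Equation n
criticalPair (A₁ ⟶ mono A₂ p) (B₁ ⟶ mono B₂ q) =
  mono ((AB ⊖ ms A₁) ⊕ A₂) (nz-⊕ʳ (AB ⊖ ms A₁) A₂ p) ,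
  mono ((AB ⊖ ms B₁) ⊕ B₂) (nz-⊕ʳ (AB ⊖ ms B₁) B₂ q)
  where
    AB = (ms A₁ ⊕ ms B₁) ⊖ (ms A₁ ⊗ ms B₁)

data ACCC {n : ℕ} (SC : List (Fin n × Fin n)) (SF : List (Equation n))
          : Mono n → Mono n → Set where
  baseC : ∀ {c d} → (c , d) ∈ SC → ACCC SC SF (const c) (const d)
  baseF : ∀ {s t} → (s , t) ∈ SF → ACCC SC SF s t
  refl  : ∀ {s} → ACCC SC SF s s
  sym   : ∀ {s t} → ACCC SC SF s t → ACCC SC SF t s
  trans : ∀ {s t u} → ACCC SC SF s t → ACCC SC SF t u → ACCC SC SF s u
  cong  : ∀ {M₁ M₂ N₁ N₂} → ACCC SC SF M₁ M₂ → ACCC SC SF N₁ N₂ →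
          ACCC SC SF (M₁ ∪ N₁) (M₂ ∪ N₂)

-- Algorithm SingleACCompletion, as a (nondeterministic) transition system

data EqC {n : ℕ} (SC : List (Fin n × Fin n)) : Fin n → Fin n → Set where
  base  : ∀ {c d} → (c , d) ∈ SC → EqC SC c d
  refl  : ∀ {c} → EqC SC c c
  sym   : ∀ {c d} → EqC SC c d → EqC SC d c
  trans : ∀ {c d e} → EqC SC c d → EqC SC d e → EqC SC c e

IsLeastRep : ∀ {n} → Rel (Fin n) 0ℓ → List (Fin n × Fin n) → (Fin n → Fin n) → Set
IsLeastRep _≫_ SC hat =
  ∀ c → EqC SC c (hat c) × (∀ d → EqC SC c d → d ≡ hat c ⊎ d ≫ hat c)

ruleSetC : ∀ {n} → (Fin n → Fin n) → List (Rule n)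
ruleSetC {n} hat =
  map (λ c → const c ⟶ const (hat c)) (filter (λ c → ¬? (c ≟ hat c)) (allFin n))

State : ℕ → Set
State n = List (Rule n) × List (Equation n)

Initial : ∀ {n} → Rel (Fin n) 0ℓ → List (Fin n × Fin n) → List (Equation n) → State n → Set
Initial _≫_ SC SF st = ∃[ hat ] (IsLeastRep _≫_ SC hat × st ≡ (ruleSetC hat , SF))

-- step (4): inter-reduction of the old rules R by the new rule ν, in the
-- context of the rule set Rf = ν ∷ R; produces the kept/modified rules and
-- the equations moved back to T
data Interreduce {n : ℕ} (Rf : List (Rule n)) (ν : Rule n)
     : List (Rule n) → List (Rule n) → List (Equation n) → Set where
  done  : Interreduce Rf ν [] [] []
  move  : ∀ {l r R R' E} → ms (lhs ν) ⊆ₘ ms l →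
          Interreduce Rf ν R R' E →
          Interreduce Rf ν ((l ⟶ r) ∷ R) R' ((l , r) ∷ E)
  rhsNF : ∀ {l r r' R R' E} → ¬ (ms (lhs ν) ⊆ₘ ms l) →
          ms (lhs ν) ⊆ₘ ms r → NormalForm Rf (apply ν r) r' →
          Interreduce Rf ν R R' E →
          Interreduce Rf ν ((l ⟶ r) ∷ R) ((l ⟶ r') ∷ R') E
  keep  : ∀ {l r R R' E} → ¬ (ms (lhs ν) ⊆ₘ ms l) →
          ¬ (ms (lhs ν) ⊆ₘ ms r) →
          Interreduce Rf ν R R' E →
          Interreduce Rf ν ((l ⟶ r) ∷ R) ((l ⟶ r) ∷ R') E

data Step {n : ℕ} (_≫f_ : Rel (Mono n) 0ℓ) : State n → State n → Set where
  discard : ∀ {R T₁ T₂ l r u} →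
            NormalForm R l u → NormalForm R r u →
            Step _≫f_ (R , T₁ ++ (l , r) ∷ T₂) (R , T₁ ++ T₂)
  add     : ∀ {R T₁ T₂ l r l̂ r̂ L Rr R' E} →
            NormalForm R l l̂ → NormalForm R r r̂ → l̂ ≢ r̂ →
            ((L , Rr) ≡ (l̂ , r̂) ⊎ (L , Rr) ≡ (r̂ , l̂)) → L ≫f Rr →
            Interreduce ((L ⟶ Rr) ∷ R) (L ⟶ Rr) R R' E →
            Step _≫f_ (R , T₁ ++ (l , r) ∷ T₂)
                      ((L ⟶ Rr) ∷ R' ,
                       T₁ ++ T₂ ++ map (criticalPair (L ⟶ Rr)) R ++ E)

Final : ∀ {n} → State n → Set
Final (R , T) = T ≡ [] ×
  (∀ ρ₁ ρ₂ → ρ₁ ∈ R → ρ₂ ∈ R →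
     Joinable R (proj₁ (criticalPair ρ₁ ρ₂)) (proj₂ (criticalPair ρ₁ ρ₂)))

IsOutput : ∀ {n} → Rel (Mono n) 0ℓ → Rel (Fin n) 0ℓ →
           List (Fin n × Fin n) → List (Equation n) → List (Rule n) → Set
IsOutput _≫f_ _≫_ SC SF R =
  ∃[ st₀ ] ∃[ T ] (Initial _≫_ SC SF st₀ × Star (Step _≫f_) st₀ (R , T) × Final (R , T))

module Submission where

-- Every state (R , T) reached by the algorithm satisfies an invariant: the
-- rules of R decrease for ≫f, the rules and pending equations are consequences
-- of S, and conversely ACCC(S) is contained in the congruence presented by R
-- and T.  Only the inter-reduction of step (4) needs an argument: an old rule
-- l → r whose right-hand side was rewritten to r′ is recovered from the new
-- rule l → r′ and the rewrite sequence r ⟶* r′, all of whose steps start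
-- below l, by well-founded induction on ≫f.  In the final state T is empty,
-- so ACCC(S) is the congruence generated by R_f.  R_f terminates because ≫f is
-- well founded and compatible with contexts, all critical pairs are joinable,
-- so R_f is locally confluent and hence confluent by Newman's lemma, and the
-- congruence generated by a convergent system is joinability.

open import Defs hiding (refl; sym; trans; cong)
open import Level using (0ℓ)
open import Function using (flip; _∘_; _⇔_; mk⇔)
open import Data.Bool using (T)
open import Data.Unit using (tt)
open import Data.Empty using (⊥-elim)
open import Data.Product as Product using (_×_; _,_; proj₁; proj₂; ∃-syntax; swap)
open import Data.Sum as Sum using (_⊎_; inj₁; inj₂)
open import Data.Nat using (ℕ; zero; suc; _+_; _∸_; _⊓_; _⊔_; _≤_)
open import Data.Nat.Properties
  using ( +-comm; +-assoc; +-identityˡ; +-∸-assoc; m∸n+n≡m; n∸n≡0; ≤-refl; ≤-total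
        ; m≤n⇒m⊓n≡m; m≥n⇒m⊓n≡n; m≤n⇒m⊔n≡n; m≥n⇒m⊔n≡m; m+n∸m≡n; m+n∸n≡m
        ; m≤m⊔n; m≤n⊔m; ⊔-lub; m≤n⇒m≤o+n; _≤?_)
import Data.Nat.Properties as ℕ
open import Data.Fin using (Fin; _≟_)
open import Data.Vec using ([]; _∷_; replicate)
open import Data.Vec.Properties using (zipWith-comm; zipWith-assoc; zipWith-identityˡ; ≡-dec)
open import Data.Vec.Relation.Binary.Pointwise.Inductive as Pointwise using ([]; _∷_)
open import Data.List using (List; []; _∷_; _++_; map; allFin)
open import Data.List.Membership.Propositional using (_∈_; find; lose)
open import Data.List.Membership.Propositional.Properties
  using (∈-++⁺ˡ; ∈-++⁺ʳ; ∈-map⁺; ∈-filter⁺; ∈-allFin)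
open import Data.List.Relation.Unary.Any using (any?; here; there)
open import Data.List.Relation.Unary.All as All using (All; []; _∷_)
import Data.List.Relation.Unary.All.Properties as All
open import Data.List.Relation.Binary.Permutation.Propositional using (↭-sym)
open import Data.List.Relation.Binary.Permutation.Propositional.Properties using (All-resp-↭; shift)
open import Relation.Nullary using (Dec; yes; no; ¬?)
open import Relation.Nullary.Decidable using (map′)
open import Relation.Unary using (Pred)
open import Relation.Binary
  using (Rel; Transitive; Symmetric; Asymmetric; IsEquivalence; IsStrictTotalOrder)
open import Relation.Binary.PropositionalEquality as P using (_≡_; _≢_; subst; subst₂)
open import Relation.Binary.Construct.Closure.ReflexiveTransitive using (Star; ε; _◅_; _◅◅_)
open import Relation.Binary.Construct.Closure.Transitive using (Plus; [_]; _∼⁺⟨_⟩_)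
open import Relation.Binary.Rewriting using (WeaklyConfluent; sn&wcr⇒cr)
open import Induction.WellFounded using (Acc; acc; module Subrelation)

private variable k : ℕ

+-∸-⊓≡⊔ : ∀ a b → a + b ∸ (a ⊓ b) ≡ a ⊔ b
+-∸-⊓≡⊔ a b with ≤-total a b
... | inj₁ a≤b rewrite m≤n⇒m⊓n≡m a≤b | m≤n⇒m⊔n≡n a≤b = m+n∸m≡n a b
... | inj₂ b≤a rewrite m≥n⇒m⊓n≡n b≤a | m≥n⇒m⊔n≡m b≤a = m+n∸n≡m a b

⊆ₘ-refl : {A : MSet k} → A ⊆ₘ A
⊆ₘ-refl = Pointwise.refl ≤-refl

nz-⊆ₘ : {A M : MSet k} → A ⊆ₘ M → T (nz A) → T (nz M)
nz-⊆ₘ (_∷_ {x = zero} {y = zero} _ A⊆M) p = nz-⊆ₘ A⊆M p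
nz-⊆ₘ (_∷_ {x = zero} {y = suc _} _ _) _ = tt
nz-⊆ₘ (_∷_ {x = suc _} {y = suc _} _ _) _ = tt

⊆ₘ-⊕ : (Y : MSet k) {A M : MSet k} → A ⊆ₘ M → A ⊆ₘ (Y ⊕ M)
⊆ₘ-⊕ [] [] = []
⊆ₘ-⊕ (y ∷ Y) (a≤m ∷ A⊆M) = m≤n⇒m≤o+n y a≤m ∷ ⊆ₘ-⊕ Y A⊆M

empty-or-nonempty : (Y : MSet k) → Y ≡ replicate k 0 ⊎ T (nz Y)
empty-or-nonempty [] = inj₁ P.refl
empty-or-nonempty (suc _ ∷ Y) = inj₂ tt
empty-or-nonempty (zero ∷ Y) with empty-or-nonempty Y
... | inj₁ Y≡0 = inj₁ (P.cong (0 ∷_) Y≡0)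
... | inj₂ p = inj₂ p

⊖-self : (A : MSet k) → A ⊖ A ≡ replicate k 0
⊖-self [] = P.refl
⊖-self (a ∷ A) = P.cong₂ _∷_ (n∸n≡0 a) (⊖-self A)

⊖-⊕-cancel : {A M : MSet k} → A ⊆ₘ M → (M ⊖ A) ⊕ A ≡ M
⊖-⊕-cancel [] = P.refl
⊖-⊕-cancel (a≤m ∷ A⊆M) = P.cong₂ _∷_ (m∸n+n≡m a≤m) (⊖-⊕-cancel A⊆M)

⊕-⊖-assoc : (Y : MSet k) {A M : MSet k} → A ⊆ₘ M → (Y ⊕ M) ⊖ A ≡ Y ⊕ (M ⊖ A)
⊕-⊖-assoc [] [] = P.refl
⊕-⊖-assoc (y ∷ Y) (a≤m ∷ A⊆M) = P.cong₂ _∷_ (+-∸-assoc y a≤m) (⊕-⊖-assoc Y A⊆M)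

-- The multiset AB of the critical-pair definition: the pointwise maximum of A and B.
lcm : MSet k → MSet k → MSet k
lcm A B = (A ⊕ B) ⊖ (A ⊗ B)

⊆ₘ-lcmˡ : (A B : MSet k) → A ⊆ₘ lcm A B
⊆ₘ-lcmˡ [] [] = []
⊆ₘ-lcmˡ (a ∷ A) (b ∷ B) = subst (a ≤_) (P.sym (+-∸-⊓≡⊔ a b)) (m≤m⊔n a b) ∷ ⊆ₘ-lcmˡ A B

⊆ₘ-lcmʳ : (A B : MSet k) → B ⊆ₘ lcm A B
⊆ₘ-lcmʳ [] [] = []
⊆ₘ-lcmʳ (a ∷ A) (b ∷ B) = subst (b ≤_) (P.sym (+-∸-⊓≡⊔ a b)) (m≤n⊔m a b) ∷ ⊆ₘ-lcmʳ A B

lcm-least : {A B M : MSet k} → A ⊆ₘ M → B ⊆ₘ M → lcm A B ⊆ₘ M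
lcm-least [] [] = []
lcm-least {A = a ∷ _} {B = b ∷ _} (a≤m ∷ A⊆M) (b≤m ∷ B⊆M) =
  subst (_≤ _) (P.sym (+-∸-⊓≡⊔ a b)) (⊔-lub a≤m b≤m) ∷ lcm-least A⊆M B⊆M

ms-injective : {s t : Mono k} → ms s ≡ ms t → s ≡ t
ms-injective P.refl = P.refl

-- Adding a possibly empty multiset to a monomial.  Both M ∪ N and
-- apply ρ M are instances: definitionally, M ∪ N ≡ ms M ⊞ N and
-- apply ρ M ≡ (ms M ⊖ ms (lhs ρ)) ⊞ rhs ρ.
infixr 6 _⊞_
_⊞_ : MSet k → Mono k → Mono k
Y ⊞ mono s p = mono (Y ⊕ s) (nz-⊕ʳ Y s p)

0⊞ : (s : Mono k) → replicate k 0 ⊞ s ≡ s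
0⊞ s = ms-injective (zipWith-identityˡ +-identityˡ (ms s))

⊞-assoc : (Y Z : MSet k) (s : Mono k) → (Y ⊕ Z) ⊞ s ≡ Y ⊞ Z ⊞ s
⊞-assoc Y Z s = ms-injective (zipWith-assoc +-assoc Y Z (ms s))

∪-comm : (M N : Mono k) → M ∪ N ≡ N ∪ M
∪-comm M N = ms-injective (zipWith-comm +-comm (ms M) (ms N))

⊖-⊞-cancel : (A M : Mono k) → ms A ⊆ₘ ms M → (ms M ⊖ ms A) ⊞ A ≡ M
⊖-⊞-cancel A M A⊆M = ms-injective (⊖-⊕-cancel A⊆M)

apply-lhs : (ρ : Rule k) → apply ρ (lhs ρ) ≡ rhs ρ
apply-lhs ρ = P.trans (P.cong (_⊞ rhs ρ) (⊖-self (ms (lhs ρ)))) (0⊞ (rhs ρ))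

apply-⊞ : (ρ : Rule k) (Y : MSet k) {s : Mono k} → ms (lhs ρ) ⊆ₘ ms s →
          apply ρ (Y ⊞ s) ≡ Y ⊞ apply ρ s
apply-⊞ ρ Y {s} lhs⊆s = P.trans (P.cong (_⊞ rhs ρ) (⊕-⊖-assoc Y lhs⊆s))
                                 (⊞-assoc Y (ms s ⊖ ms (lhs ρ)) (rhs ρ))

superposition : Rule k → Rule k → Mono k
superposition (mono A p ⟶ _) ρ = mono (lcm A (ms (lhs ρ))) (nz-⊆ₘ (⊆ₘ-lcmˡ A (ms (lhs ρ))) p)

criticalPair≡ : (ρ₁ ρ₂ : Rule k) →
                criticalPair ρ₁ ρ₂ ≡ (apply ρ₁ (superposition ρ₁ ρ₂) , apply ρ₂ (superposition ρ₁ ρ₂))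
criticalPair≡ (_ ⟶ mono _ _) (_ ⟶ mono _ _) = P.refl

_holdsIn_ : Equation k → Rel (Mono k) 0ℓ → Set
(s , t) holdsIn _~_ = s ~ t

AllRules : Rel (Mono k) 0ℓ → List (Rule k) → Set
AllRules _~_ = All (λ ρ → lhs ρ ~ rhs ρ)

AllEquations : Rel (Mono k) 0ℓ → List (Equation k) → Set
AllEquations _~_ = All (_holdsIn _~_)

⊞-Compatible : Rel (Mono k) 0ℓ → Set
⊞-Compatible {k} _~_ = ∀ (Y : MSet k) {s t} → s ~ t → (Y ⊞ s) ~ (Y ⊞ t)

module _ {_~_ : Rel (Mono k) 0ℓ} where

  ∪-compatible⇒⊞-compatible : (∀ M {s t} → s ~ t → (M ∪ s) ~ (M ∪ t)) → ⊞-Compatible _~_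
  ∪-compatible⇒⊞-compatible compat Y {s} {t} s~t with empty-or-nonempty Y
  ... | inj₁ P.refl = subst₂ _~_ (P.sym (0⊞ s)) (P.sym (0⊞ t)) s~t
  ... | inj₂ p = compat (mono Y p) s~t

  module _ (compat : ⊞-Compatible _~_) where

    apply-compatible : ∀ {ρ M} → lhs ρ ~ rhs ρ → ms (lhs ρ) ⊆ₘ ms M → M ~ apply ρ M
    apply-compatible {ρ} {M} lhs~rhs lhs⊆M =
      subst (_~ apply ρ M) (⊖-⊞-cancel (lhs ρ) M lhs⊆M) (compat (ms M ⊖ ms (lhs ρ)) lhs~rhs)

    ⟶₁⇒ : ∀ {R} → AllRules _~_ R → ∀ {s t} → R ⊢ s ⟶₁ t → s ~ t
    ⟶₁⇒ rules (ρ , ρ∈R , lhs⊆s , P.refl) = apply-compatible (All.lookup rules ρ∈R) lhs⊆s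

    ~-⟶* : Transitive _~_ → ∀ {R} → AllRules _~_ R → ∀ {a b c} → a ~ b → R ⊢ b ⟶* c → a ~ c
    ~-⟶* trans rules a~b ε = a~b
    ~-⟶* trans rules a~b (step ◅ steps) = ~-⟶* trans rules (trans a~b (⟶₁⇒ rules step)) steps

record IsCongruence {k} (_~_ : Rel (Mono k) 0ℓ) : Set where
  field
    isEquivalence : IsEquivalence _~_
    ∪-cong        : ∀ {M₁ M₂ N₁ N₂} → M₁ ~ M₂ → N₁ ~ N₂ → (M₁ ∪ N₁) ~ (M₂ ∪ N₂)

  open IsEquivalence isEquivalence public

  ⊞-compatible : ⊞-Compatible _~_
  ⊞-compatible = ∪-compatible⇒⊞-compatible (λ M → ∪-cong (refl {M}))

  ⟶*⇒ : ∀ {R} → AllRules _~_ R → ∀ {s t} → R ⊢ s ⟶* t → s ~ t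
  ⟶*⇒ rules = ~-⟶* ⊞-compatible trans rules refl

  criticalPair-holds : ∀ {ρ₁ ρ₂} → lhs ρ₁ ~ rhs ρ₁ → lhs ρ₂ ~ rhs ρ₂ → criticalPair ρ₁ ρ₂ holdsIn _~_
  criticalPair-holds {ρ₁} {ρ₂} rule₁ rule₂ =
    subst (_holdsIn _~_) (P.sym (criticalPair≡ ρ₁ ρ₂))
          (trans (sym (apply-compatible ⊞-compatible {M = X} rule₁ (⊆ₘ-lcmˡ A₁ A₂)))
                 (apply-compatible ⊞-compatible {M = X} rule₂ (⊆ₘ-lcmʳ A₁ A₂)))
    where
    A₁ = ms (lhs ρ₁)
    A₂ = ms (lhs ρ₂)
    X = superposition ρ₁ ρ₂

module _ {SC : List (Fin k × Fin k)} {SF : List (Equation k)} where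

  ACCC-isCongruence : IsCongruence (ACCC SC SF)
  ACCC-isCongruence = record
    { isEquivalence = record { refl = ACCC.refl ; sym = ACCC.sym ; trans = ACCC.trans }
    ; ∪-cong = ACCC.cong }

  ACCC-minimal : ∀ {_~_ : Rel (Mono k) 0ℓ} → IsCongruence _~_ →
                 (∀ {c d} → (c , d) ∈ SC → const c ~ const d) →
                 AllEquations _~_ SF → ∀ {s t} → ACCC SC SF s t → s ~ t
  ACCC-minimal {_~_} ~-cong constants equations = go
    where
    open IsCongruence ~-cong
    go : ∀ {s t} → ACCC SC SF s t → s ~ t
    go (baseC cd∈SC) = constants cd∈SC
    go (baseF st∈SF) = All.lookup equations st∈SF
    go ACCC.refl = refl
    go (ACCC.sym p) = sym (go p)
    go (ACCC.trans p q) = trans (go p) (go q)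
    go (ACCC.cong p q) = ∪-cong (go p) (go q)

module _ {R : List (Rule k)} where

  ⟶₁-⊞ : ⊞-Compatible (R ⊢_⟶₁_)
  ⟶₁-⊞ Y {s} (ρ , ρ∈R , lhs⊆s , P.refl) = ρ , ρ∈R , ⊆ₘ-⊕ Y lhs⊆s , P.sym (apply-⊞ ρ Y {s} lhs⊆s)

  ⟶*-⊞ : ⊞-Compatible (R ⊢_⟶*_)
  ⟶*-⊞ Y ε = ε
  ⟶*-⊞ Y (_◅_ {i = s} {j = t} step steps) = ⟶₁-⊞ Y {s} {t} step ◅ ⟶*-⊞ Y steps

  ⟶*-∪ : ∀ {a a′ b b′} → R ⊢ a ⟶* a′ → R ⊢ b ⟶* b′ → R ⊢ (a ∪ b) ⟶* (a′ ∪ b′)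
  ⟶*-∪ {a} {a′} {b} {b′} a⟶*a′ b⟶*b′ =
    ⟶*-⊞ (ms a) b⟶*b′ ◅◅ subst₂ (R ⊢_⟶*_) (∪-comm b′ a) (∪-comm b′ a′) (⟶*-⊞ (ms b′) a⟶*a′)

  Joinable-⊞ : ⊞-Compatible (Joinable R)
  Joinable-⊞ Y (w , s⟶*w , t⟶*w) = Y ⊞ w , ⟶*-⊞ Y s⟶*w , ⟶*-⊞ Y t⟶*w

  Joinable-isCongruence : Confluent R → IsCongruence (Joinable R)
  Joinable-isCongruence confluent = record
    { isEquivalence = record
      { refl = _ , ε , ε
      ; sym = λ (w , s⟶*w , t⟶*w) → w , t⟶*w , s⟶*w
      ; trans = λ (v , s⟶*v , t⟶*v) (w , t⟶*w , u⟶*w) →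
                  let z , v⟶*z , w⟶*z = confluent _ _ _ t⟶*v t⟶*w
                  in z , s⟶*v ◅◅ v⟶*z , u⟶*w ◅◅ w⟶*z }
    ; ∪-cong = λ (v , s⟶*v , t⟶*v) (w , s′⟶*w , t′⟶*w) →
                 v ∪ w , ⟶*-∪ s⟶*v s′⟶*w , ⟶*-∪ t⟶*v t′⟶*w }

  -- Every peak is an instance of the critical peak at the superposition of the two rules.
  criticalPairs⇒weaklyConfluent :
    (∀ ρ₁ ρ₂ → ρ₁ ∈ R → ρ₂ ∈ R → criticalPair ρ₁ ρ₂ holdsIn Joinable R) →
    WeaklyConfluent (R ⊢_⟶₁_)
  criticalPairs⇒weaklyConfluent joinable {s}
    (ρ₁ , ρ₁∈R , lhs₁⊆s , P.refl) (ρ₂ , ρ₂∈R , lhs₂⊆s , P.refl) =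
    subst₂ (Joinable R) (in-context ρ₁ lhs₁⊆X) (in-context ρ₂ lhs₂⊆X) (Joinable-⊞ Z critical)
    where
    X = superposition ρ₁ ρ₂
    Z = ms s ⊖ ms X
    lhs₁⊆X = ⊆ₘ-lcmˡ (ms (lhs ρ₁)) (ms (lhs ρ₂))
    lhs₂⊆X = ⊆ₘ-lcmʳ (ms (lhs ρ₁)) (ms (lhs ρ₂))
    in-context : ∀ ρ → ms (lhs ρ) ⊆ₘ ms X → Z ⊞ apply ρ X ≡ apply ρ s
    in-context ρ lhs⊆X = P.trans (P.sym (apply-⊞ ρ Z {X} lhs⊆X))
                                 (P.cong (apply ρ) (⊖-⊞-cancel X s (lcm-least lhs₁⊆s lhs₂⊆s)))
    critical : Joinable R (apply ρ₁ X) (apply ρ₂ X)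
    critical = subst (_holdsIn Joinable R) (criticalPair≡ ρ₁ ρ₂) (joinable ρ₁ ρ₂ ρ₁∈R ρ₂∈R)

  reducible? : (s : Mono k) → Dec (Reducible R s)
  reducible? s =
    map′ (λ applicable → let ρ , ρ∈R , lhs⊆s = find applicable in apply ρ s , ρ , ρ∈R , lhs⊆s , P.refl)
         (λ (_ , _ , ρ∈R , lhs⊆s , _) → lose ρ∈R lhs⊆s)
         (any? (λ ρ → Pointwise.decidable _≤?_ (ms (lhs ρ)) (ms s)) R)

  normalForm-exists : ∀ {s} → Acc (flip (R ⊢_⟶₁_)) s → ∃[ u ] NormalForm R s u
  normalForm-exists {s} (acc smaller) with reducible? s
  ... | no irreducible = s , ε , irreducible
  ... | yes (t , s⟶t) = let u , t⟶*u , nf = normalForm-exists (smaller s⟶t) in u , s⟶t ◅ t⟶*u , nf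

  rules-joinable : AllRules (Joinable R) R
  rules-joinable = All.tabulate λ {ρ} ρ∈R → rhs ρ , (ρ , ρ∈R , ⊆ₘ-refl , P.sym (apply-lhs ρ)) ◅ ε , ε

  joinable⇒commonNormalForm : Terminating R → ∀ {s t} → Joinable R s t →
                              ∃[ u ] (NormalForm R s u × NormalForm R t u)
  joinable⇒commonNormalForm terminating (w , s⟶*w , t⟶*w) =
    let u , w⟶*u , irreducible = normalForm-exists (terminating w)
    in u , (s⟶*w ◅◅ w⟶*u , irreducible) , (t⟶*w ◅◅ w⟶*u , irreducible)

module AdmissibleOrder {_≫_ : Rel (Fin k) 0ℓ} (ord : Admissible _≫_) where
  open Admissible ord
  open IsStrictTotalOrder totalOrder public using () renaming (trans to ≫f-trans)

  ≫f-⊞-compatible : ⊞-Compatible _≫f_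
  ≫f-⊞-compatible = ∪-compatible⇒⊞-compatible λ M {s} {t} s≫t →
    subst₂ _≫f_ (∪-comm s M) (∪-comm t M) (monotone s t M s≫t)

  ⊆ₘ-≫f-trans : ∀ {A M t} → ms A ⊆ₘ ms M → A ≫f t → M ≫f t
  ⊆ₘ-≫f-trans {A} {M} A⊆M A≫t with ≡-dec ℕ._≟_ (ms A) (ms M)
  ... | yes A≡M = subst (_≫f _) (ms-injective A≡M) A≫t
  ... | no A≢M = ≫f-trans (subset M A (A⊆M , A≢M)) A≫t

  module _ {R : List (Rule k)} (decreasing : AllRules _≫f_ R) where

    ⟶₁⇒≫f : ∀ {s t} → R ⊢ s ⟶₁ t → s ≫f t
    ⟶₁⇒≫f = ⟶₁⇒ ≫f-⊞-compatible decreasing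

    terminating : Terminating R
    terminating = Subrelation.wellFounded ⟶₁⇒≫f wellFounded

    confluent : (∀ ρ₁ ρ₂ → ρ₁ ∈ R → ρ₂ ∈ R → criticalPair ρ₁ ρ₂ holdsIn Joinable R) → Confluent R
    confluent joinable _ _ _ =
      sn&wcr⇒cr {_⟶_ = R ⊢_⟶₁_} (Subrelation.wellFounded {_<₂_ = flip _≫f_} ⟶⁺⇒≫f wellFounded)
                (λ {s} {t} {u} → criticalPairs⇒weaklyConfluent {R = R} joinable {s} {t} {u})
      where
      ⟶⁺⇒≫f : ∀ {s t} → Plus (R ⊢_⟶₁_) s t → s ≫f t
      ⟶⁺⇒≫f [ step ] = ⟶₁⇒≫f step
      ⟶⁺⇒≫f (_ ∼⁺⟨ steps ⟩ steps′) = ≫f-trans (⟶⁺⇒≫f steps) (⟶⁺⇒≫f steps′)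

equation : Rule k → Equation k
equation ρ = lhs ρ , rhs ρ

-- ACCC without constant equations is the congruence closure of a list of
-- equations; here, of the rules and pending equations of a completion state.
Presented : List (Rule k) → List (Equation k) → Rel (Mono k) 0ℓ
Presented R T = ACCC [] (map equation R ++ T)

module _ (R : List (Rule k)) (T : List (Equation k)) where

  rules-presented : AllRules (Presented R T) R
  rules-presented = All.tabulate λ ρ∈R → baseF (∈-++⁺ˡ (∈-map⁺ equation ρ∈R))

  pending-presented : AllEquations (Presented R T) T
  pending-presented = All.tabulate λ e∈T → baseF (∈-++⁺ʳ _ e∈T)

module _ {R : List (Rule k)} {T : List (Equation k)} where

  Presented-minimal : ∀ {_~_ : Rel (Mono k) 0ℓ} → IsCongruence _~_ →
                      AllRules _~_ R → AllEquations _~_ T → ∀ {s t} → Presented R T s t → s ~ t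
  Presented-minimal ~-cong rules pending = ACCC-minimal ~-cong (λ ()) (All.++⁺ (All.map⁺ rules) pending)

module _ {P : Pred (Equation k) 0ℓ} (T₁ : List (Equation k)) {x : Equation k}
         {T₂ : List (Equation k)} where

  All-insert : P x → All P (T₁ ++ T₂) → All P (T₁ ++ x ∷ T₂)
  All-insert px all = All-resp-↭ (↭-sym (shift x T₁ T₂)) (px ∷ all)

  All-remove : All P (T₁ ++ x ∷ T₂) → P x × All P (T₁ ++ T₂)
  All-remove all = All.uncons (All-resp-↭ (shift x T₁ T₂) all)

oriented : ∀ {_~_ : Rel (Mono k) 0ℓ} → Symmetric _~_ → ∀ {a b x y} →
           (a , b) ≡ (x , y) ⊎ (a , b) ≡ (y , x) → x ~ y → a ~ b
oriented sym (inj₁ P.refl) x~y = x~y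
oriented sym (inj₂ P.refl) x~y = sym x~y

swap-orientation : ∀ {a b x y : Mono k} →
                   (a , b) ≡ (x , y) ⊎ (a , b) ≡ (y , x) → (x , y) ≡ (a , b) ⊎ (x , y) ≡ (b , a)
swap-orientation = Sum.map P.sym (P.cong swap ∘ P.sym)

module _ {_~_ : Rel (Mono k) 0ℓ} (compat : ⊞-Compatible _~_) (trans : Transitive _~_)
         {Rf : List (Rule k)} {ν : Rule k} (rules : AllRules _~_ Rf) (ν-rule : lhs ν ~ rhs ν) where

  interreduce-preserves : ∀ {R R′ E} → Interreduce Rf ν R R′ E → AllRules _~_ R →
                          AllRules _~_ R′ × AllEquations _~_ E
  interreduce-preserves done [] = [] , []
  interreduce-preserves (move _ ir) (l~r ∷ rest) = Product.map₂ (l~r ∷_) (interreduce-preserves ir rest)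
  interreduce-preserves (keep _ _ ir) (l~r ∷ rest) = Product.map₁ (l~r ∷_) (interreduce-preserves ir rest)
  interreduce-preserves (rhsNF _ lhsν⊆r (r⟶*r′ , _) ir) (l~r ∷ rest) =
    Product.map₁ (~-⟶* compat trans rules (trans l~r (apply-compatible compat ν-rule lhsν⊆r)) r⟶*r′ ∷_)
                 (interreduce-preserves ir rest)

module _ {Rf : List (Rule k)} {ν : Rule k} where

  interreduce-old : ∀ {R R′ E} → Interreduce Rf ν R R′ E → ∀ {ρ} → ρ ∈ R →
                    equation ρ ∈ E ⊎ ρ ∈ R′ ⊎
                    ∃[ r′ ] ((lhs ρ ⟶ r′) ∈ R′ × ms (lhs ν) ⊆ₘ ms (rhs ρ) ×
                             NormalForm Rf (apply ν (rhs ρ)) r′)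
  interreduce-old (move _ _) (here P.refl) = inj₁ (here P.refl)
  interreduce-old (keep _ _ _) (here P.refl) = inj₂ (inj₁ (here P.refl))
  interreduce-old (rhsNF _ lhsν⊆r nf _) (here P.refl) = inj₂ (inj₂ (_ , here P.refl , lhsν⊆r , nf))
  interreduce-old (move _ ir) (there ρ∈R) = Sum.map₁ there (interreduce-old ir ρ∈R)
  interreduce-old (keep _ _ ir) (there ρ∈R) = Sum.map₂ later (interreduce-old ir ρ∈R)
    where later = Sum.map there (Product.map₂ (Product.map₁ there))
  interreduce-old (rhsNF _ _ _ ir) (there ρ∈R) = Sum.map₂ later (interreduce-old ir ρ∈R)
    where later = Sum.map there (Product.map₂ (Product.map₁ there))

module _ {_≫_ : Rel (Fin k) 0ℓ} (≫-asym : Asymmetric _≫_)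
         {SC : List (Fin k × Fin k)} {hat : Fin k → Fin k}
         (least : IsLeastRep _≫_ SC hat) where

  leastRep-cong : ∀ {c d} → EqC SC c d → hat c ≡ hat d
  leastRep-cong {c} {d} c~d with proj₂ (least d) (hat c) (EqC.trans (EqC.sym c~d) (proj₁ (least c)))
                               | proj₂ (least c) (hat d) (EqC.trans c~d (proj₁ (least d)))
  ... | inj₁ ĉ≡d̂ | _ = ĉ≡d̂
  ... | inj₂ _ | inj₁ d̂≡ĉ = P.sym d̂≡ĉ
  ... | inj₂ ĉ≫d̂ | inj₂ d̂≫ĉ = ⊥-elim (≫-asym ĉ≫d̂ d̂≫ĉ)

  ruleSetC-all : ∀ {P : Pred (Rule k) 0ℓ} → (∀ {c} → c ≢ hat c → P (const c ⟶ const (hat c))) →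
                 All P (ruleSetC hat)
  ruleSetC-all rule = All.map⁺ (All.map rule (All.all-filter (λ c → ¬? (c ≟ hat c)) (allFin k)))

  leastRep-presented : ∀ {SF} c → Presented (ruleSetC hat) SF (const c) (const (hat c))
  leastRep-presented {SF} c with c ≟ hat c
  ... | yes c≡ĉ = subst (λ d → Presented (ruleSetC hat) SF (const c) (const d)) c≡ĉ ACCC.refl
  ... | no c≢ĉ = All.lookup (rules-presented (ruleSetC hat) SF)
                            (∈-map⁺ (λ c → const c ⟶ const (hat c))
                                    (∈-filter⁺ (λ c → ¬? (c ≟ hat c)) (∈-allFin c) c≢ĉ))

EqC⇒ACCC : ∀ {SC : List (Fin k × Fin k)} {SF c d} → EqC SC c d → ACCC SC SF (const c) (const d)
EqC⇒ACCC (base cd∈SC) = baseC cd∈SC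
EqC⇒ACCC EqC.refl = ACCC.refl
EqC⇒ACCC (EqC.sym c~d) = ACCC.sym (EqC⇒ACCC c~d)
EqC⇒ACCC (EqC.trans c~d d~e) = ACCC.trans (EqC⇒ACCC c~d) (EqC⇒ACCC d~e)

module Completion {_≫_ : Rel (Fin k) 0ℓ} (≫-isStrictTotalOrder : IsStrictTotalOrder _≡_ _≫_)
                  (ord : Admissible _≫_) (SC : List (Fin k × Fin k)) (SF : List (Equation k)) where
  open Admissible ord
  open AdmissibleOrder ord

  _≈_ : Rel (Mono k) 0ℓ
  _≈_ = ACCC SC SF

  module ≈ = IsCongruence (ACCC-isCongruence {SC = SC} {SF})

  record Invariant (R : List (Rule k)) (T : List (Equation k)) : Set where
    field
      decreasing    : AllRules _≫f_ R
      sound-rules   : AllRules _≈_ R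
      sound-pending : AllEquations _≈_ T
      complete      : ∀ {s t} → s ≈ t → Presented R T s t

  initial-invariant : ∀ {hat} → IsLeastRep _≫_ SC hat → Invariant (ruleSetC hat) SF
  initial-invariant {hat} least = record
    { decreasing = ruleSetC-all asym least decreases
    ; sound-rules = ruleSetC-all asym least λ {c} _ → EqC⇒ACCC (proj₁ (least c))
    ; sound-pending = All.tabulate baseF
    ; complete = ACCC-minimal ACCC-isCongruence constants (pending-presented (ruleSetC hat) SF) }
    where
    open IsStrictTotalOrder ≫-isStrictTotalOrder using (asym)
    decreases : ∀ {c} → c ≢ hat c → const c ≫f const (hat c)
    decreases {c} c≢ĉ with proj₂ (least c) c EqC.refl
    ... | inj₁ c≡ĉ = ⊥-elim (c≢ĉ c≡ĉ)
    ... | inj₂ c≫ĉ = extends c (hat c) c≫ĉ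
    constants : ∀ {c d} → (c , d) ∈ SC → Presented (ruleSetC hat) SF (const c) (const d)
    constants {c} {d} cd∈SC =
      ACCC.trans (leastRep-presented asym least {SF} c)
        (subst (λ e → Presented (ruleSetC hat) SF (const e) (const d))
               (P.sym (leastRep-cong asym least (base cd∈SC)))
               (ACCC.sym (leastRep-presented asym least {SF} d)))

  discard-invariant : ∀ {R T₁ T₂ l r u} → NormalForm R l u → NormalForm R r u →
                      Invariant R (T₁ ++ (l , r) ∷ T₂) → Invariant R (T₁ ++ T₂)
  discard-invariant {R} {T₁} {T₂} (l⟶*u , _) (r⟶*u , _) I = record
    { decreasing = decreasing
    ; sound-rules = sound-rules
    ; sound-pending = proj₂ (All-remove T₁ sound-pending)
    ; complete = Presented-minimal ACCC-isCongruence rules (All-insert T₁ l≈r pending) ∘ complete }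
    where
    open Invariant I
    open IsCongruence ACCC-isCongruence using (⟶*⇒)
    rules = rules-presented R (T₁ ++ T₂)
    pending = pending-presented R (T₁ ++ T₂)
    l≈r = ACCC.trans (⟶*⇒ rules l⟶*u) (ACCC.sym (⟶*⇒ rules r⟶*u))

  module AddRule {R T₁ T₂ l r l̂ r̂ L Rr R′ E}
                 (I : Invariant R (T₁ ++ (l , r) ∷ T₂))
                 (l⟶*l̂ : R ⊢ l ⟶* l̂) (r⟶*r̂ : R ⊢ r ⟶* r̂)
                 (orientation : (L , Rr) ≡ (l̂ , r̂) ⊎ (L , Rr) ≡ (r̂ , l̂)) (L≫Rr : L ≫f Rr)
                 (ir : Interreduce ((L ⟶ Rr) ∷ R) (L ⟶ Rr) R R′ E) where
    open Invariant I

    ν : Rule k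
    ν = L ⟶ Rr

    T⁺ : List (Equation k)
    T⁺ = T₁ ++ T₂ ++ map (criticalPair ν) R ++ E

    _≈⁺_ : Rel (Mono k) 0ℓ
    _≈⁺_ = Presented (ν ∷ R′) T⁺
    module ≈⁺ = IsCongruence (ACCC-isCongruence {SC = []} {SF = map equation (ν ∷ R′) ++ T⁺})

    rules⁺ : AllRules _≈⁺_ (ν ∷ R′)
    rules⁺ = rules-presented (ν ∷ R′) T⁺

    pending⁺ : AllEquations _≈⁺_ T⁺
    pending⁺ = pending-presented (ν ∷ R′) T⁺

    ν-sound : L ≈ Rr
    ν-sound = oriented ≈.sym orientation
      (≈.trans (≈.sym (≈.⟶*⇒ sound-rules l⟶*l̂))
               (≈.trans (proj₁ (All-remove T₁ sound-pending)) (≈.⟶*⇒ sound-rules r⟶*r̂)))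

    ≫f-interreduced : AllRules _≫f_ R′ × AllEquations _≫f_ E
    ≫f-interreduced =
      interreduce-preserves ≫f-⊞-compatible ≫f-trans (L≫Rr ∷ decreasing) L≫Rr ir decreasing

    ≈-interreduced : AllRules _≈_ R′ × AllEquations _≈_ E
    ≈-interreduced =
      interreduce-preserves ≈.⊞-compatible ≈.trans (ν-sound ∷ sound-rules) ν-sound ir sound-rules

    sound-pending⁺ : AllEquations _≈_ T⁺
    sound-pending⁺ =
      let T₁-sound , T₂-sound = All.++⁻ T₁ (proj₂ (All-remove T₁ sound-pending))
          criticalPairs-sound = All.map⁺ (All.map (≈.criticalPair-holds ν-sound) sound-rules)
      in All.++⁺ T₁-sound (All.++⁺ T₂-sound (All.++⁺ criticalPairs-sound (proj₂ ≈-interreduced)))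

    old-rule : ∀ {s ρ} → Acc (flip _≫f_) s → ρ ∈ R → ms (lhs ρ) ⊆ₘ ms s → lhs ρ ≈⁺ rhs ρ
    old-rule {s} {ρ} (acc below) ρ∈R lhs⊆s with interreduce-old ir ρ∈R
    ... | inj₁ moved = All.lookup pending⁺ (∈-++⁺ʳ T₁ (∈-++⁺ʳ T₂ (∈-++⁺ʳ _ moved)))
    ... | inj₂ (inj₁ kept) = All.lookup rules⁺ (there kept)
    ... | inj₂ (inj₂ (r′ , reduced , lhsν⊆rhs , rhs⟶*r′ , _)) =
          ≈⁺.trans (All.lookup rules⁺ (there reduced))
                   (≈⁺.sym (path (⊆ₘ-≫f-trans lhs⊆s (All.lookup decreasing ρ∈R))
                                 ((ν , here P.refl , lhsν⊆rhs , P.refl) ◅ rhs⟶*r′)))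
      where
      step : ∀ {x y} → Acc (flip _≫f_) x → (ν ∷ R) ⊢ x ⟶₁ y → x ≈⁺ y
      step _ (_ , here P.refl , lhs⊆x , P.refl) =
        apply-compatible ≈⁺.⊞-compatible (All.head rules⁺) lhs⊆x
      step acc-x (_ , there ρ′∈R , lhs⊆x , P.refl) =
        apply-compatible ≈⁺.⊞-compatible (old-rule acc-x ρ′∈R lhs⊆x) lhs⊆x
      path : ∀ {x y} → s ≫f x → (ν ∷ R) ⊢ x ⟶* y → x ≈⁺ y
      path _ ε = ≈⁺.refl
      path {x} s≫x (_◅_ {j = x′} x⟶x′ x′⟶*y) =
        ≈⁺.trans (step {x} {x′} (below s≫x) x⟶x′)
                 (path (≫f-trans s≫x (⟶₁⇒≫f (L≫Rr ∷ decreasing) {x} {x′} x⟶x′)) x′⟶*y)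

    old-rules : AllRules _≈⁺_ R
    old-rules = All.tabulate λ {ρ} ρ∈R → old-rule (wellFounded (lhs ρ)) ρ∈R ⊆ₘ-refl

    invariant : Invariant (ν ∷ R′) T⁺
    invariant = record
      { decreasing = L≫Rr ∷ proj₁ ≫f-interreduced
      ; sound-rules = ν-sound ∷ proj₁ ≈-interreduced
      ; sound-pending = sound-pending⁺
      ; complete = Presented-minimal ACCC-isCongruence old-rules (All-insert T₁ l≈⁺r old-pending)
                   ∘ complete }
      where
      old-pending = All.++⁺ (All.++⁻ˡ T₁ pending⁺) (All.++⁻ˡ T₂ (All.++⁻ʳ T₁ pending⁺))
      l≈⁺r = ≈⁺.trans (≈⁺.⟶*⇒ old-rules l⟶*l̂)
               (≈⁺.trans (oriented ≈⁺.sym (swap-orientation orientation) (All.head rules⁺))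
                         (≈⁺.sym (≈⁺.⟶*⇒ old-rules r⟶*r̂)))

  State-invariant : State k → Set
  State-invariant (R , T) = Invariant R T

  step-invariant : ∀ {st st′} → Step _≫f_ st st′ → State-invariant st → State-invariant st′
  step-invariant (discard l↓ r↓) = discard-invariant l↓ r↓
  step-invariant (add (l⟶*l̂ , _) (r⟶*r̂ , _) _ orientation L≫Rr ir) I =
    AddRule.invariant I l⟶*l̂ r⟶*r̂ orientation L≫Rr ir

  run-invariant : ∀ {st st′} → Star (Step _≫f_) st st′ → State-invariant st → State-invariant st′
  run-invariant ε I = I
  run-invariant (step ◅ steps) I = run-invariant steps (step-invariant step I)

theorem3p5 : ∀ (n : ℕ) (_≫_ : Rel (Fin n) 0ℓ) → IsStrictTotalOrder _≡_ _≫_ →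
    (ord : Admissible _≫_) →
    (SC : List (Fin n × Fin n)) (SF : List (Equation n)) (Rf : List (Rule n)) →
    IsOutput (Admissible._≫f_ ord) _≫_ SC SF Rf →
    Canonical Rf ×
    (∀ (s t : Mono n) → ACCC SC SF s t ⇔ (∃[ u ] (NormalForm Rf s u × NormalForm Rf t u)))
theorem3p5 _ _ ≫-isStrictTotalOrder ord SC SF Rf
           (_ , _ , (_ , least , P.refl) , run , (P.refl , criticalPairs-joinable)) =
  (terminating decreasing , Rf-confluent) , λ s t → mk⇔ ACCC⇒commonNormalForm (commonNormalForm⇒ACCC s t)
  where
  open AdmissibleOrder ord
  open Completion ≫-isStrictTotalOrder ord SC SF
  open Invariant (run-invariant run (initial-invariant least))

  Rf-confluent : Confluent Rf
  Rf-confluent = confluent decreasing criticalPairs-joinable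

  ACCC⇒commonNormalForm : ∀ {s t} → s ≈ t → ∃[ u ] (NormalForm Rf s u × NormalForm Rf t u)
  ACCC⇒commonNormalForm = joinable⇒commonNormalForm (terminating decreasing)
         ∘ Presented-minimal (Joinable-isCongruence Rf-confluent) rules-joinable []
         ∘ complete

  commonNormalForm⇒ACCC : ∀ s t → ∃[ u ] (NormalForm Rf s u × NormalForm Rf t u) → s ≈ t
  commonNormalForm⇒ACCC _ _ (_ , (s⟶*u , _) , (t⟶*u , _)) =
    ≈.trans (≈.⟶*⇒ sound-rules s⟶*u) (≈.sym (≈.⟶*⇒ sound-rules t⟶*u))
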